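{- Let $t\ge1$, $n=2(t+1)^2$, let $\mathcal{C}_0\subseteq\mathbb{Z}_n^2$ be a linear $t$-error-correcting diameter perfect code with generator matrix $G_0$, and let $\mathcal{C}=\mathbf{x}+\mathcal{C}_0$ for some $\mathbf{x}=(x_1,x_2)\in\mathbb{Z}_n^2$. Suppose $\mathcal{C}$ is of Case I or of Case II, and let $\mathcal{S}$ be the set of diameter perfect Sudoku grids with respect to $\mathcal{C}$ and $\mathcal{A}$. (i) If $\mathcal{C}$ is of Case I, let $\mathcal{G}_\mathcal{S}=\langle \tau_1^{t+1}\tau_2^{t+1},\ \tau_2^{2(t+1)},\ \tau_2^{2x_2+1}s,\ \tau_1^{2x_1+2}\tau_2^{2x_2+1}r^2\rangle$. (ii) If $\mathcal{C}$ is of Case II and $G_0=[a~~b]$, let $\mathcal{G}_\mathcal{S}=\langle \tau_1^{a}\tau_2^{b},\ \tau_1^{2x_1+2}\tau_2^{2x_2+1}r^2\rangle$. Then for every $S\in\mathcal{S}$ and every $g\in\mathcal{G}_\mathcal{S}$, we have $g(S)\in\mathcal{S}$.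
   Context: $\mathbb{Z}_n$ is the ring of integers modulo $n$; Lee weight of $\mathbf{u}=(u_1,u_2)$ (entries in $\{0,\dots,n-1\}$) is $\sum_i\min\{u_i,n-u_i\}$, Lee distance $d_L(\mathbf{u},\mathbf{v})=\mathrm{wt}_L(\mathbf{u}-\mathbf{v})$. A code is a subset of $\mathbb{Z}_n^2$, linear if a submodule; the code with a generator matrix is the $\mathbb{Z}_n$-span of its rows. Two codes $\mathcal{C}_1,\mathcal{C}_2$ are equivalent if $\mathcal{C}_1P=\mathcal{C}_2$ for a permutation matrix $P$ (i.e. equal, or equal after swapping coordinates). For a code $\mathcal{C}$ and $\mathbf{c}\in\mathcal{C}$, let $\mathcal{A}(\mathbf{c})$ be the set of points of $\mathbb{Z}_n^2$ at Lee distance at most $t$ from $\mathbf{c}$ or from $\mathbf{c}+(1,0)$ (a translate of the maximum anticode $\mathcal{A}_{2t+1}$ of diameter $2t+1$, of size $n$, with core $\{\mathbf{c},\mathbf{c}+(1,0)\}$). A $t$-error-correcting diameter perfect code (a $(2t+1)$-diameter perfect code with minimum distance $2t+2$ and anticode $\mathcal{A}_{2t+1}$) is a code $\mathcal{C}$ of minimum Lee distance $2t+2$ with $|\mathcal{C}|\cdot|\mathcal{A}_{2t+1}|=n^2$; then the sets $\mathcal{A}(\mathbf{c})$, $\mathbf{c}\in\mathcal{C}$, partition $\mathbb{Z}_n^2$. For $\mathcal{C}=\{\mathbf{c}_1,\dots,\mathbf{c}_n\}$, $\mathcal{A}=\{\mathcal{A}(\mathbf{c}_i)\}$ and the palette grid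 $\mathcal{I}_{\mathcal{C},\mathcal{A}}$ is the $n\times n$ array (rows/columns indexed by $0,\dots,n-1$) with entry $i$ at every $(x,y)\in\mathcal{A}(\mathbf{c}_i)$. Two $n\times n$ arrays over $[n]=\{1,\dots,n\}$ are orthogonal if the ordered pairs of corresponding entries are pairwise distinct. A diameter perfect Sudoku grid with respect to $\mathcal{C}$ and $\mathcal{A}$ is a Latin square over $[n]$ orthogonal to $\mathcal{I}_{\mathcal{C},\mathcal{A}}$. Let $\mathcal{C}'$ be the code generated by $\begin{bmatrix}t+1&t+1\\0&2(t+1)\end{bmatrix}$ and $\mathcal{C}''$ the code generated by $[1~~2t+1]$. $\mathcal{C}=\mathbf{x}+\mathcal{C}_0$ is of Case I if $\mathcal{C}_0$ is equivalent to $\mathcal{C}'$, and of Case II if $\mathcal{C}_0$ is equivalent to $\mathcal{C}''$. On $n\times n$ arrays (indices in $\{0,\dots,n-1\}$ taken mod $n$): $(r(A))_{i,j}=A_{n-1-j,i}$, $(s(A))_{i,j}=A_{i,n-1-j}$, $(\tau_1(A))_{i,j}=A_{i-1,j}$, $(\tau_2(A))_{i,j}=A_{i,j-1}$; products denote composition and $\mathcal{G}_\mathcal{S}$ is the generated group. -}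

module Defs where

open import Data.Nat using (ℕ; zero; suc; NonZero; _+_; _*_; _∸_; _≤_; _⊓_)
open import Data.Nat.DivMod using (_%_; m%n<n)
open import Data.Fin using (Fin; toℕ; fromℕ<)
open import Data.Product using (_×_; _,_; proj₁; proj₂; Σ; ∃)
open import Data.Sum using (_⊎_)
open import Data.List using (List; _∷_; [])
open import Data.List.Membership.Propositional using (_∈_)
open import Relation.Binary.PropositionalEquality using (_≡_; _≢_)
open import Relation.Nullary using (¬_)
open import Function using (_∘_; id)
open import Function.Definitions using (Injective; Bijective)

N : ℕ → ℕ
N t = 2 * (suc t * suc t)

-- NonZero (N t) holds by computation: N t reduces to suc _

-- Z_n represented by Fin n (canonical residues 0..n-1), arithmetic mod n

module _ (n : ℕ) {{_ : NonZero n}} where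

  [_] : ℕ → Fin n
  [ m ] = fromℕ< (m%n<n m n)

  _+ₙ_ : Fin n → Fin n → Fin n
  a +ₙ b = [ toℕ a + toℕ b ]

  _-ₙ_ : Fin n → Fin n → Fin n
  a -ₙ b = [ toℕ a + (n ∸ toℕ b) ]

  _·ₙ_ : Fin n → Fin n → Fin n
  k ·ₙ a = [ toℕ k * toℕ a ]

  Pt : Set
  Pt = Fin n × Fin n

  _⊕_ : Pt → Pt → Pt
  (a₁ , a₂) ⊕ (b₁ , b₂) = (a₁ +ₙ b₁) , (a₂ +ₙ b₂)

  _⊖_ : Pt → Pt → Pt
  (a₁ , a₂) ⊖ (b₁ , b₂) = (a₁ -ₙ b₁) , (a₂ -ₙ b₂)

  _⊙_ : Fin n → Pt → Pt
  k ⊙ (a₁ , a₂) = (k ·ₙ a₁) , (k ·ₙ a₂)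

  0ₚ : Pt
  0ₚ = [ 0 ] , [ 0 ]

  pt : ℕ → ℕ → Pt
  pt a b = [ a ] , [ b ]

  swapₚ : Pt → Pt
  swapₚ (a , b) = b , a

  wtL₁ : Fin n → ℕ
  wtL₁ u = toℕ u ⊓ (n ∸ toℕ u)

  wtL : Pt → ℕ
  wtL (u₁ , u₂) = wtL₁ u₁ + wtL₁ u₂

  dL : Pt → Pt → ℕ
  dL u v = wtL (u ⊖ v)

  Code : Set₁
  Code = Pt → Set

  record IsLinear (C : Code) : Set where
    field
      has-zero : C 0ₚ
      closed-+ : ∀ u v → C u → C v → C (u ⊕ v)
      closed-· : ∀ k u → C u → C (k ⊙ u)

  Enumerates : {k : ℕ} → (Fin k → Pt) → Code → Set
  Enumerates e C = Injective _≡_ _≡_ e × (∀ i → C (e i)) × (∀ p → C p → ∃ λ i → e i ≡ p)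

  HasSize : ℕ → Code → Set
  HasSize k C = Σ (Fin k → Pt) λ e → Enumerates e C

  MinDist : Code → ℕ → Set
  MinDist C d = (∀ u v → C u → C v → u ≢ v → d ≤ dL u v)
              × (Σ Pt λ u → Σ Pt λ v → C u × C v × u ≢ v × dL u v ≡ d)

  -- translate of the maximum anticode A_{2t+1} with core {c, c+(1,0)}
  Anticode : ℕ → Pt → Pt → Set
  Anticode t c p = dL p c ≤ t ⊎ dL p (c ⊕ pt 1 0) ≤ t

  -- t-error-correcting diameter perfect code:
  -- minimum distance 2t+2 and |C|·|A_{2t+1}| = n², where |A_{2t+1}| = n, i.e. |C| = n
  IsDiamPerfect : ℕ → Code → Set
  IsDiamPerfect t C = MinDist C (2 * t + 2) × HasSize n C

  Span : List Pt → Code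
  Span [] p = p ≡ 0ₚ
  Span (g ∷ gs) p = Σ (Fin n) λ k → Σ Pt λ q → Span gs q × p ≡ (k ⊙ g) ⊕ q

  SameCode : Code → Code → Set
  SameCode C D = ∀ p → (C p → D p) × (D p → C p)

  -- equivalence: C₁ P = C₂ for a 2×2 permutation matrix P
  Equivalent : Code → Code → Set
  Equivalent C D = SameCode C D ⊎ SameCode (C ∘ swapₚ) D

  Translate : Pt → Code → Code
  Translate x C₀ p = Σ Pt λ c → C₀ c × p ≡ x ⊕ c

  C′ : ℕ → Code
  C′ t = Span (pt (suc t) (suc t) ∷ pt 0 (2 * suc t) ∷ [])

  C″ : ℕ → Code
  C″ t = Span (pt 1 (2 * t + 1) ∷ [])

  CaseI : ℕ → Code → Set
  CaseI t C₀ = Equivalent C₀ (C′ t)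

  CaseII : ℕ → Code → Set
  CaseII t C₀ = Equivalent C₀ (C″ t)

  -- n×n arrays over [n] (symbol i+1 represented by i : Fin n)

  Arr : Set
  Arr = Fin n → Fin n → Fin n

  IsPaletteGrid : ℕ → (Fin n → Pt) → Arr → Set
  IsPaletteGrid t e I = ∀ i p → Anticode t (e i) p → I (proj₁ p) (proj₂ p) ≡ i

  IsLatin : Arr → Set
  IsLatin L = (∀ i → Bijective _≡_ _≡_ (L i)) × (∀ j → Bijective _≡_ _≡_ (λ i → L i j))

  Orthogonal : Arr → Arr → Set
  Orthogonal A B = ∀ i j k l → (i , j) ≢ (k , l) → (A i j , B i j) ≢ (A k l , B k l)

  IsDPSudoku : Arr → Arr → Set
  IsDPSudoku I L = IsLatin L × Orthogonal L I

  one : Fin n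
  one = [ 1 ]

  rev : Fin n → Fin n
  rev j = [ n ∸ suc (toℕ j) ]

  rₐ sₐ τ₁ₐ τ₂ₐ r⁻¹ₐ τ₁⁻¹ₐ τ₂⁻¹ₐ : Arr → Arr
  rₐ A i j = A (rev j) i
  sₐ A i j = A i (rev j)
  τ₁ₐ A i j = A (i -ₙ one) j
  τ₂ₐ A i j = A i (j -ₙ one)
  r⁻¹ₐ A i j = A j (rev i)
  τ₁⁻¹ₐ A i j = A (i +ₙ one) j
  τ₂⁻¹ₐ A i j = A i (j +ₙ one)

data Expr : Set where
  `r `s `τ₁ `τ₂ `id : Expr
  _∘ₑ_ : Expr → Expr → Expr
  _⁻¹ₑ : Expr → Expr

_^ₑ_ : Expr → ℕ → Expr
e ^ₑ zero = `id
e ^ₑ suc k = e ∘ₑ (e ^ₑ k)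

module _ (n : ℕ) {{_ : NonZero n}} where
  ⟦_⟧ : Expr → Arr n → Arr n
  ⟦_⟧⁻ : Expr → Arr n → Arr n
  ⟦ `r ⟧ = rₐ n
  ⟦ `s ⟧ = sₐ n
  ⟦ `τ₁ ⟧ = τ₁ₐ n
  ⟦ `τ₂ ⟧ = τ₂ₐ n
  ⟦ `id ⟧ = id
  ⟦ e ∘ₑ f ⟧ = ⟦ e ⟧ ∘ ⟦ f ⟧
  ⟦ e ⁻¹ₑ ⟧ = ⟦ e ⟧⁻
  ⟦ `r ⟧⁻ = r⁻¹ₐ n
  ⟦ `s ⟧⁻ = sₐ n
  ⟦ `τ₁ ⟧⁻ = τ₁⁻¹ₐ n
  ⟦ `τ₂ ⟧⁻ = τ₂⁻¹ₐ n
  ⟦ `id ⟧⁻ = id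
  ⟦ e ∘ₑ f ⟧⁻ = ⟦ f ⟧⁻ ∘ ⟦ e ⟧⁻
  ⟦ e ⁻¹ₑ ⟧⁻ = ⟦ e ⟧

data InGroup (G : List Expr) : Expr → Set where
  gen  : ∀ {g} → g ∈ G → InGroup G g
  unit : InGroup G `id
  comp : ∀ {g h} → InGroup G g → InGroup G h → InGroup G (g ∘ₑ h)
  inv  : ∀ {g} → InGroup G g → InGroup G (g ⁻¹ₑ)

-- generators; exponents are the natural representatives of elements of Z_n
-- Case I: τ₁^{t+1}τ₂^{t+1}, τ₂^{2(t+1)}, τ₂^{2x₂+1}s, τ₁^{2x₁+2}τ₂^{2x₂+1}r²
gensI : (t : ℕ) → Pt (N t) → List Expr
gensI t (x₁ , x₂) =
  ((`τ₁ ^ₑ suc t) ∘ₑ (`τ₂ ^ₑ suc t))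
  ∷ (`τ₂ ^ₑ (2 * suc t))
  ∷ ((`τ₂ ^ₑ (2 * toℕ x₂ + 1)) ∘ₑ `s)
  ∷ ((`τ₁ ^ₑ (2 * toℕ x₁ + 2)) ∘ₑ ((`τ₂ ^ₑ (2 * toℕ x₂ + 1)) ∘ₑ (`r ^ₑ 2)))
  ∷ []

gensII : (t : ℕ) → Pt (N t) → Fin (N t) → Fin (N t) → List Expr
gensII t (x₁ , x₂) a b =
  ((`τ₁ ^ₑ toℕ a) ∘ₑ (`τ₂ ^ₑ toℕ b))
  ∷ ((`τ₁ ^ₑ (2 * toℕ x₁ + 2)) ∘ₑ ((`τ₂ ^ₑ (2 * toℕ x₂ + 1)) ∘ₑ (`r ^ₑ 2)))
  ∷ []

-- S is described via an
-- enumeration e of C = {c_1..c_n} and the palette grid I of (C, A).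
PreservesSudoku : (t : ℕ) → Code (N t) → List Expr → Set
PreservesSudoku t C gs =
  ∀ (e : Fin (N t) → Pt (N t)) → Enumerates (N t) e C →
  ∀ (I : Arr (N t)) → IsPaletteGrid (N t) t e I →
  ∀ (S : Arr (N t)) → IsDPSudoku (N t) I S →
  ∀ g → InGroup gs g → IsDPSudoku (N t) I (⟦_⟧ (N t) g S)

-- Every generator acts on the cells of a grid as an affine isometry of Z_n² for the Lee metric:
-- a translation by a codeword of C₀, the half-turn about the centre x + (½ , 0) of the core of x,
-- or (in Case I) the reflection j ↦ 2 x₂ - j of the columns. Such a map sends every core
-- {c , c + (1 , 0)} onto a core, hence every anticode A(c) into an anticode; as the anticodes
-- cover Z_n², it maps cells of equal palette colour to cells of equal colour, so it keeps a grid
-- orthogonal to the palette grid, while it keeps Latin squares Latin because it maps rows and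
-- columns onto rows and columns. The covering needs no counting: in the rotated coordinates
-- (i + j , i - j) the anticode A₀ becomes the box [-t , t + 1]² and the lattice of codewords a
-- shear of 2T ℤ² (T = t + 1), so reducing both rotated coordinates puts every cell into an anticode.
module Submission where

open import Defs
open import Data.Nat using (ℕ; _≤_)
open import Data.Fin using (Fin)
open import Data.Product using (_×_; _,_)
open import Data.List using (_∷_; [])

open import Data.Nat as ℕ using (zero; suc; NonZero; _∸_; _⊓_)
import Data.Nat.Properties as ℕP
import Data.Nat.DivMod as ℕD
import Data.Nat.Tactic.RingSolver as ℕSolver
open import Data.Fin using (toℕ)
import Data.Fin.Properties as FinP
open import Data.Product using (Σ-syntax; proj₁; proj₂)
open import Data.Sum using (_⊎_; inj₁; inj₂)
open import Data.Integer using (ℤ; +_; -[1+_]; +0; +[1+_]; ∣_∣; _+_; _*_; _-_; -_; _/ℕ_; _%ℕ_)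
import Data.Integer.Properties as ℤP
open import Data.Integer.DivMod using (n%ℕd<d; a≡a%ℕn+[a/ℕn]*n)
open import Data.Integer.Tactic.RingSolver using (solve-∀)
open import Data.Empty using (⊥-elim)
open import Data.Sign as Sign using (Sign)
open import Data.List.Membership.Propositional using (_∈_)
open import Data.List.Relation.Unary.Any using (here; there)
open import Function using (_∘_)
open import Function.Definitions using (Bijective)
open import Function.Consequences.Propositional
  using (inverseᵇ⇒bijective; strictlyInverseˡ⇒inverseˡ; strictlyInverseʳ⇒inverseʳ)
import Function.Construct.Composition as Compose
open import Relation.Binary.PropositionalEquality
  using (_≡_; _≢_; refl; sym; trans; cong; cong₂; subst; module ≡-Reasoning)

module ZMod (n : ℕ) {{_ : NonZero n}} where

  infix 4 _≈_
  record _≈_ (a b : ℤ) : Set where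
    constructor _,_
    field
      quotient : ℤ
      difference : a ≡ b + quotient * + n

  ≈-refl : ∀ {a} → a ≈ a
  ≈-refl {a} = + 0 , sym (ℤP.+-identityʳ a)

  ≡⇒≈ : ∀ {a b} → a ≡ b → a ≈ b
  ≡⇒≈ refl = ≈-refl

  ≈-flip : ∀ {a} b k → a ≡ b + k * + n → b ≡ a + - k * + n
  ≈-flip b k refl = shift b k (+ n)
    where
    shift : ∀ b k m → b ≡ b + k * m + - k * m
    shift = solve-∀

  ≈-sym : ∀ {a b} → a ≈ b → b ≈ a
  ≈-sym {b = b} (k , eq) = - k , ≈-flip b k eq

  ≈-trans : ∀ {a b c} → a ≈ b → b ≈ c → a ≈ c
  ≈-trans {c = c} (k , refl) (l , refl) = l + k , shift c k l (+ n)
    where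
    shift : ∀ c k l m → c + l * m + k * m ≡ c + (l + k) * m
    shift = solve-∀

  +-cong : ∀ {a b c d} → a ≈ b → c ≈ d → a + c ≈ b + d
  +-cong {b = b} {d = d} (k , refl) (l , refl) = k + l , shift b d k l (+ n)
    where
    shift : ∀ b d k l m → b + k * m + (d + l * m) ≡ b + d + (k + l) * m
    shift = solve-∀

  neg-cong : ∀ {a b} → a ≈ b → - a ≈ - b
  neg-cong {b = b} (k , refl) = - k , shift b k (+ n)
    where
    shift : ∀ b k m → - (b + k * m) ≡ - b + - k * m
    shift = solve-∀

  -‿cong : ∀ {a b c d} → a ≈ b → c ≈ d → a - c ≈ b - d
  -‿cong a≈b c≈d = +-cong a≈b (neg-cong c≈d)

  n≈0 : + n ≈ + 0
  n≈0 = + 1 , sym (trans (ℤP.+-identityˡ _) (ℤP.*-identityˡ (+ n)))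

  private
    no-wrap : ∀ {r s} m → r ℕ.< n → + r ≢ + s + +[1+ m ] * + n
    no-wrap {r} {s} m r<n eq = ℕP.<-irrefl refl (ℕP.<-≤-trans r<n n≤r)
      where
      pos-sum : ∀ s m → + (s ℕ.+ suc m ℕ.* n) ≡ + s + +[1+ m ] * + n
      pos-sum s m = trans (ℤP.pos-+ s _) (cong (_+_ (+ s)) (ℤP.pos-* (suc m) n))
      n≤r : n ≤ r
      n≤r = ℕP.≤-trans (ℕP.m≤n*m n (suc m))
              (ℕP.≤-trans (ℕP.m≤n+m _ s) (ℕP.≤-reflexive (sym (ℤP.+-injective (trans eq (sym (pos-sum s m)))))))

  residue-unique : ∀ {r s} → r ℕ.< n → s ℕ.< n → + r ≈ + s → r ≡ s
  residue-unique _   _   (+0 , eq)        = ℤP.+-injective (trans eq (ℤP.+-identityʳ _))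
  residue-unique r<n _   (+[1+ m ] , eq)  = ⊥-elim (no-wrap m r<n eq)
  residue-unique _   s<n (-[1+ m ] , eq)  = ⊥-elim (no-wrap m s<n (≈-flip (+ _) -[1+ m ] eq))

  ι : Fin n → ℤ
  ι u = + toℕ u

  ⟪_⟫ : ℤ → Fin n
  ⟪ z ⟫ = Data.Fin.fromℕ< (n%ℕd<d z n)

  ι⟪⟫ : ∀ z → ι ⟪ z ⟫ ≈ z
  ι⟪⟫ z = - (z /ℕ n) , trans (cong +_ (FinP.toℕ-fromℕ< _)) (≈-flip (+ _) (z /ℕ n) (a≡a%ℕn+[a/ℕn]*n z n))

  ⟪⟫-cong : ∀ {a b} → a ≈ b → ⟪ a ⟫ ≡ ⟪ b ⟫
  ⟪⟫-cong {a} {b} a≈b = FinP.toℕ-injective (residue-unique (FinP.toℕ<n ⟪ a ⟫) (FinP.toℕ<n ⟪ b ⟫)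
    (≈-trans (ι⟪⟫ a) (≈-trans a≈b (≈-sym (ι⟪⟫ b)))))

  ⟪ι⟫ : ∀ u → ⟪ ι u ⟫ ≡ u
  ⟪ι⟫ u = FinP.toℕ-injective (residue-unique (FinP.toℕ<n ⟪ ι u ⟫) (FinP.toℕ<n u) (ι⟪⟫ (ι u)))

  ⟪⟫-≈ : ∀ {a b} → ⟪ a ⟫ ≡ ⟪ b ⟫ → a ≈ b
  ⟪⟫-≈ {a} {b} eq = ≈-trans (≈-sym (ι⟪⟫ a)) (subst (λ u → ι u ≈ b) (sym eq) (ι⟪⟫ b))

  *-cong : ∀ {a b c d} → a ≈ b → c ≈ d → a * c ≈ b * d
  *-cong {b = b} {d = d} (k , refl) (l , refl) = k * d + b * l + k * l * + n , expand b d k l (+ n)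
    where
    expand : ∀ b d k l m → (b + k * m) * (d + l * m) ≡ b * d + (k * d + b * l + k * l * m) * m
    expand = solve-∀

  ∸-≈ : ∀ {m} → m ≤ n → + (n ∸ m) ≈ - + m
  ∸-≈ {m} m≤n = ≈-trans (≡⇒≈ (trans (sym (ℤP.⊖-≥ m≤n)) (sym (ℤP.m-n≡m⊖n n m))))
                        (≈-trans (+-cong n≈0 (≈-refl { - + m})) (≡⇒≈ (ℤP.+-identityˡ (- + m))))

  -- Defs' residue [ m ] is definitionally ⟪ + m ⟫, so the operations of Defs on Fin n unfold to ⟪_⟫
  -- of integer expressions in the representatives ι.
  +ₙ-⟪⟫ : ∀ a b → _+ₙ_ n ⟪ a ⟫ ⟪ b ⟫ ≡ ⟪ a + b ⟫
  +ₙ-⟪⟫ a b = ⟪⟫-cong (+-cong (ι⟪⟫ a) (ι⟪⟫ b))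

  -ₙ-⟪⟫ : ∀ a b → _-ₙ_ n ⟪ a ⟫ ⟪ b ⟫ ≡ ⟪ a - b ⟫
  -ₙ-⟪⟫ a b = ⟪⟫-cong (+-cong (ι⟪⟫ a) (≈-trans (∸-≈ (ℕP.<⇒≤ (FinP.toℕ<n ⟪ b ⟫))) (neg-cong (ι⟪⟫ b))))

  ·ₙ-⟪⟫ : ∀ a b → _·ₙ_ n ⟪ a ⟫ ⟪ b ⟫ ≡ ⟪ a * b ⟫
  ·ₙ-⟪⟫ a b = trans (cong ⟪_⟫ (ℤP.pos-* (toℕ ⟪ a ⟫) (toℕ ⟪ b ⟫))) (⟪⟫-cong (*-cong (ι⟪⟫ a) (ι⟪⟫ b)))

  rev-⟪⟫ : ∀ a → rev n ⟪ a ⟫ ≡ ⟪ - + 1 - a ⟫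
  rev-⟪⟫ a = ⟪⟫-cong (≈-trans (∸-≈ (FinP.toℕ<n ⟪ a ⟫))
                     (≈-trans (≡⇒≈ (ℤP.neg-distrib-+ (+ 1) (ι ⟪ a ⟫))) (-‿cong (≈-refl { - + 1}) (ι⟪⟫ a))))

  P : ℤ → ℤ → Pt n
  P a b = ⟪ a ⟫ , ⟪ b ⟫

  P-ι : ∀ p → P (ι (proj₁ p)) (ι (proj₂ p)) ≡ p
  P-ι (u , v) = cong₂ _,_ (⟪ι⟫ u) (⟪ι⟫ v)

  P-cong : ∀ {a a′ b b′} → a ≈ a′ → b ≈ b′ → P a b ≡ P a′ b′
  P-cong a≈a′ b≈b′ = cong₂ _,_ (⟪⟫-cong a≈a′) (⟪⟫-cong b≈b′)

  P-≈ : ∀ {a a′ b b′} → P a b ≡ P a′ b′ → a ≈ a′ × b ≈ b′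
  P-≈ eq = ⟪⟫-≈ (cong proj₁ eq) , ⟪⟫-≈ (cong proj₂ eq)

  ⊕-P : ∀ a b c d → _⊕_ n (P a b) (P c d) ≡ P (a + c) (b + d)
  ⊕-P a b c d = cong₂ _,_ (+ₙ-⟪⟫ a c) (+ₙ-⟪⟫ b d)

  ⊖-P : ∀ a b c d → _⊖_ n (P a b) (P c d) ≡ P (a - c) (b - d)
  ⊖-P a b c d = cong₂ _,_ (-ₙ-⟪⟫ a c) (-ₙ-⟪⟫ b d)

  ⊙-P : ∀ k a b → _⊙_ n ⟪ k ⟫ (P a b) ≡ P (k * a) (k * b)
  ⊙-P k a b = cong₂ _,_ (·ₙ-⟪⟫ k a) (·ₙ-⟪⟫ k b)

  ⊙⊕-P : ∀ k a b c d → _⊕_ n (_⊙_ n ⟪ k ⟫ (P a b)) (P c d) ≡ P (k * a + c) (k * b + d)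
  ⊙⊕-P k a b c d = trans (cong (λ q → _⊕_ n q (P c d)) (⊙-P k a b)) (⊕-P (k * a) (k * b) c d)

  generator∈Span : ∀ g → Span n (g ∷ []) g
  generator∈Span g = ⟪ + 1 ⟫ , 0ₚ n , refl , (begin
    g                                             ≡⟨ P-ι g ⟨
    P a b                                         ≡⟨ cong₂ P (one-times a) (one-times b) ⟩
    P (+ 1 * a + + 0) (+ 1 * b + + 0)             ≡⟨ ⊙⊕-P (+ 1) a b (+ 0) (+ 0) ⟨
    _⊕_ n (_⊙_ n ⟪ + 1 ⟫ (P a b)) (0ₚ n)          ≡⟨ cong (λ q → _⊕_ n (_⊙_ n ⟪ + 1 ⟫ q) (0ₚ n)) (P-ι g) ⟩
    _⊕_ n (_⊙_ n ⟪ + 1 ⟫ g) (0ₚ n)                ∎)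
    where
    open ≡-Reasoning
    a b : ℤ
    a = ι (proj₁ g)
    b = ι (proj₂ g)
    one-times : ∀ a → a ≡ + 1 * a + + 0
    one-times = solve-∀

  W : ℤ → ℕ
  W z = wtL₁ n ⟪ z ⟫

  dL-P : ∀ a b c d → dL n (P a b) (P c d) ≡ W (a - c) ℕ.+ W (b - d)
  dL-P a b c d = cong (wtL n) (⊖-P a b c d)

  private
    W-residue : ∀ {m} → m ℕ.< n → W (+ m) ≡ m ⊓ (n ∸ m)
    W-residue {m} m<n = cong (λ r → r ⊓ (n ∸ r)) (trans (FinP.toℕ-fromℕ< _) (ℕD.m<n⇒m%n≡m m<n))

    W-neg-residue : ∀ {m} → m ℕ.< n → W (- + m) ≡ W (+ m)
    W-neg-residue {zero}  _   = refl
    W-neg-residue {suc m} m<n = begin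
      W (- + suc m)                           ≡⟨ cong (wtL₁ n) (⟪⟫-cong (≈-sym (∸-≈ (ℕP.<⇒≤ m<n)))) ⟩
      W (+ (n ∸ suc m))                       ≡⟨ W-residue (ℕP.∸-monoʳ-< (ℕ.s≤s ℕ.z≤n) (ℕP.<⇒≤ m<n)) ⟩
      (n ∸ suc m) ⊓ (n ∸ (n ∸ suc m))         ≡⟨ cong ((n ∸ suc m) ⊓_) (ℕP.m∸[m∸n]≡n (ℕP.<⇒≤ m<n)) ⟩
      (n ∸ suc m) ⊓ suc m                     ≡⟨ ℕP.⊓-comm (n ∸ suc m) (suc m) ⟩
      suc m ⊓ (n ∸ suc m)                     ≡⟨ W-residue m<n ⟨
      W (+ suc m)                             ∎
      where open ≡-Reasoning

  W-neg : ∀ z → W (- z) ≡ W z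
  W-neg z = begin
    W (- z)            ≡⟨ cong (wtL₁ n) (⟪⟫-cong (neg-cong (≈-sym (ι⟪⟫ z)))) ⟩
    W (- ι ⟪ z ⟫)      ≡⟨ W-neg-residue (FinP.toℕ<n ⟪ z ⟫) ⟩
    W (ι ⟪ z ⟫)        ≡⟨ cong (wtL₁ n) (⟪ι⟫ ⟪ z ⟫) ⟩
    W z                ∎
    where open ≡-Reasoning

  W≤∣_∣ : ∀ z → W z ≤ ∣ z ∣
  W≤∣ + m ∣    = ℕP.≤-trans (ℕP.m⊓n≤m _ _) (ℕP.≤-trans (ℕP.≤-reflexive (FinP.toℕ-fromℕ< _)) (ℕD.m%n≤m m n))
  W≤∣ -[1+ m ] ∣ = subst (_≤ suc m) (sym (W-neg (+ suc m))) W≤∣ + suc m ∣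

  dL-≤ : ∀ {p q} a b c d → p ≡ P a b → q ≡ P c d → dL n p q ≤ ∣ a - c ∣ ℕ.+ ∣ b - d ∣
  dL-≤ a b c d refl refl = subst (_≤ ∣ a - c ∣ ℕ.+ ∣ b - d ∣) (sym (dL-P a b c d)) (ℕP.+-mono-≤ W≤∣ a - c ∣ W≤∣ b - d ∣)

  Isometry : (Pt n → Pt n) → Set
  Isometry f = ∀ p q → dL n (f p) (f q) ≡ dL n p q

  signed : Sign → ℤ → ℤ
  signed Sign.+ a = a
  signed Sign.- a = - a

  record Affine (s₁ s₂ : Sign) (A B : ℤ) (f : Pt n → Pt n) : Set where
    constructor affine
    field
      at-P : ∀ a b → f (P a b) ≡ P (signed s₁ a + A) (signed s₂ b + B)
  open Affine public

  private
    W-signed : ∀ s a c A → W ((signed s a + A) - (signed s c + A)) ≡ W (a - c)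
    W-signed Sign.+ a c A = cong W (cancel a c A)
      where
      cancel : ∀ a c A → (a + A) - (c + A) ≡ a - c
      cancel = solve-∀
    W-signed Sign.- a c A = trans (cong W (cancel a c A)) (W-neg (a - c))
      where
      cancel : ∀ a c A → (- a + A) - (- c + A) ≡ - (a - c)
      cancel = solve-∀

  affine-isometry : ∀ {s₁ s₂ A B f} → Affine s₁ s₂ A B f → Isometry f
  affine-isometry {s₁} {s₂} {A} {B} {f} (affine f≡) p q = begin
    dL n (f p) (f q)                  ≡⟨ cong₂ (λ p q → dL n (f p) (f q)) (sym (P-ι p)) (sym (P-ι q)) ⟩
    dL n (f (P a b)) (f (P c d))      ≡⟨ cong₂ (dL n) (f≡ a b) (f≡ c d) ⟩
    dL n (P (signed s₁ a + A) (signed s₂ b + B)) (P (signed s₁ c + A) (signed s₂ d + B))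
                                      ≡⟨ dL-P (signed s₁ a + A) (signed s₂ b + B) (signed s₁ c + A) (signed s₂ d + B) ⟩
    W ((signed s₁ a + A) - (signed s₁ c + A)) ℕ.+ W ((signed s₂ b + B) - (signed s₂ d + B))
                                      ≡⟨ cong₂ ℕ._+_ (W-signed s₁ a c A) (W-signed s₂ b d B) ⟩
    W (a - c) ℕ.+ W (b - d)           ≡⟨ dL-P a b c d ⟨
    dL n (P a b) (P c d)              ≡⟨ cong₂ (dL n) (P-ι p) (P-ι q) ⟩
    dL n p q                          ∎
    where
    open ≡-Reasoning
    a b c d : ℤ
    a = ι (proj₁ p)
    b = ι (proj₂ p)
    c = ι (proj₁ q)
    d = ι (proj₂ q)

  inverse-offset : Sign → ℤ → ℤ
  inverse-offset Sign.+ A = - A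
  inverse-offset Sign.- A = A

  private
    signed-solve : ∀ s a A → signed s (signed s a + inverse-offset s A) + A ≡ a
    signed-solve Sign.+ a A = cancel a A
      where
      cancel : ∀ a A → a + - A + A ≡ a
      cancel = solve-∀
    signed-solve Sign.- a A = cancel a A
      where
      cancel : ∀ a A → - (- a + A) + A ≡ a
      cancel = solve-∀

  affine-inverse : ∀ {s₁ s₂ A B f g} → (∀ p → g (f p) ≡ p) → Affine s₁ s₂ A B f →
                   Affine s₁ s₂ (inverse-offset s₁ A) (inverse-offset s₂ B) g
  affine-inverse {s₁} {s₂} {A} {B} {f} {g} gf (affine f≡) = affine g≡
    where
    g≡ : ∀ a b → g (P a b) ≡ P (signed s₁ a + inverse-offset s₁ A) (signed s₂ b + inverse-offset s₂ B)
    g≡ a b = begin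
      g (P a b)        ≡⟨ cong g (trans (f≡ a′ b′) (cong₂ P (signed-solve s₁ a A) (signed-solve s₂ b B))) ⟨
      g (f (P a′ b′))  ≡⟨ gf (P a′ b′) ⟩
      P a′ b′          ∎
      where
      open ≡-Reasoning
      a′ b′ : ℤ
      a′ = signed s₁ a + inverse-offset s₁ A
      b′ = signed s₂ b + inverse-offset s₂ B

module Arrays (n : ℕ) {{_ : NonZero n}} where
  open ZMod n

  at : Arr n → Pt n → Fin n
  at A p = A (proj₁ p) (proj₂ p)

  down up : Fin n → Fin n
  down u = _-ₙ_ n u (one n)
  up u = _+ₙ_ n u (one n)

  -- ⟦ e ⟧ A reads A at the cell ⟦ e ⟧ₚ (i , j), so composition is reversed.
  ⟦_⟧ₚ ⟦_⟧ₚ⁻ : Expr → Pt n → Pt n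
  ⟦ `r ⟧ₚ (i , j) = rev n j , i
  ⟦ `s ⟧ₚ (i , j) = i , rev n j
  ⟦ `τ₁ ⟧ₚ (i , j) = down i , j
  ⟦ `τ₂ ⟧ₚ (i , j) = i , down j
  ⟦ `id ⟧ₚ p = p
  ⟦ e ∘ₑ f ⟧ₚ p = ⟦ f ⟧ₚ (⟦ e ⟧ₚ p)
  ⟦ e ⁻¹ₑ ⟧ₚ p = ⟦ e ⟧ₚ⁻ p
  ⟦ `r ⟧ₚ⁻ (i , j) = j , rev n i
  ⟦ `s ⟧ₚ⁻ (i , j) = i , rev n j
  ⟦ `τ₁ ⟧ₚ⁻ (i , j) = up i , j
  ⟦ `τ₂ ⟧ₚ⁻ (i , j) = i , up j
  ⟦ `id ⟧ₚ⁻ p = p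
  ⟦ e ∘ₑ f ⟧ₚ⁻ p = ⟦ e ⟧ₚ⁻ (⟦ f ⟧ₚ⁻ p)
  ⟦ e ⁻¹ₑ ⟧ₚ⁻ p = ⟦ e ⟧ₚ p

  ⟦⟧-at : ∀ e A i j → ⟦_⟧ n e A i j ≡ at A (⟦ e ⟧ₚ (i , j))
  ⟦⟧⁻-at : ∀ e A i j → ⟦_⟧⁻ n e A i j ≡ at A (⟦ e ⟧ₚ⁻ (i , j))
  ⟦⟧-at `r A i j = refl
  ⟦⟧-at `s A i j = refl
  ⟦⟧-at `τ₁ A i j = refl
  ⟦⟧-at `τ₂ A i j = refl
  ⟦⟧-at `id A i j = refl
  ⟦⟧-at (e ∘ₑ f) A i j = trans (⟦⟧-at e (⟦_⟧ n f A) i j) (⟦⟧-at f A _ _)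
  ⟦⟧-at (e ⁻¹ₑ) A i j = ⟦⟧⁻-at e A i j
  ⟦⟧⁻-at `r A i j = refl
  ⟦⟧⁻-at `s A i j = refl
  ⟦⟧⁻-at `τ₁ A i j = refl
  ⟦⟧⁻-at `τ₂ A i j = refl
  ⟦⟧⁻-at `id A i j = refl
  ⟦⟧⁻-at (e ∘ₑ f) A i j = trans (⟦⟧⁻-at f (⟦_⟧⁻ n e A) i j) (⟦⟧⁻-at e A _ _)
  ⟦⟧⁻-at (e ⁻¹ₑ) A i j = ⟦⟧-at e A i j

  private
    ⟪⟫-inverse : ∀ (f g : Fin n → Fin n) (φ ψ : ℤ → ℤ) →
                 (∀ a → f ⟪ a ⟫ ≡ ⟪ φ a ⟫) → (∀ a → g ⟪ a ⟫ ≡ ⟪ ψ a ⟫) → (∀ a → ψ (φ a) ≡ a) →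
                 ∀ u → g (f u) ≡ u
    ⟪⟫-inverse f g φ ψ f≡ g≡ ψφ u = begin
      g (f u)           ≡⟨ cong (g ∘ f) (sym (⟪ι⟫ u)) ⟩
      g (f ⟪ ι u ⟫)     ≡⟨ cong g (f≡ (ι u)) ⟩
      g ⟪ φ (ι u) ⟫     ≡⟨ g≡ (φ (ι u)) ⟩
      ⟪ ψ (φ (ι u)) ⟫   ≡⟨ cong ⟪_⟫ (ψφ (ι u)) ⟩
      ⟪ ι u ⟫           ≡⟨ ⟪ι⟫ u ⟩
      u                 ∎
      where open ≡-Reasoning

    reflect-reflect : ∀ a → - + 1 - (- + 1 - a) ≡ a
    reflect-reflect = solve-∀
    sub-add : ∀ a → a - + 1 + + 1 ≡ a
    sub-add = solve-∀
    add-sub : ∀ a → a + + 1 - + 1 ≡ a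
    add-sub = solve-∀

  rev-involutive : ∀ u → rev n (rev n u) ≡ u
  rev-involutive = ⟪⟫-inverse (rev n) (rev n) (λ a → - + 1 - a) (λ a → - + 1 - a) rev-⟪⟫ rev-⟪⟫ reflect-reflect

  up-down : ∀ u → up (down u) ≡ u
  up-down = ⟪⟫-inverse down up (_- + 1) (_+ + 1) (λ a → -ₙ-⟪⟫ a (+ 1)) (λ a → +ₙ-⟪⟫ a (+ 1)) sub-add

  down-up : ∀ u → down (up u) ≡ u
  down-up = ⟪⟫-inverse up down (_+ + 1) (_- + 1) (λ a → +ₙ-⟪⟫ a (+ 1)) (λ a → -ₙ-⟪⟫ a (+ 1)) add-sub

  ⟦⟧ₚ⁻-inverseʳ : ∀ e p → ⟦ e ⟧ₚ⁻ (⟦ e ⟧ₚ p) ≡ p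
  ⟦⟧ₚ⁻-inverseˡ : ∀ e p → ⟦ e ⟧ₚ (⟦ e ⟧ₚ⁻ p) ≡ p
  ⟦⟧ₚ⁻-inverseʳ `r (i , j) = cong (i ,_) (rev-involutive j)
  ⟦⟧ₚ⁻-inverseʳ `s (i , j) = cong (i ,_) (rev-involutive j)
  ⟦⟧ₚ⁻-inverseʳ `τ₁ (i , j) = cong (_, j) (up-down i)
  ⟦⟧ₚ⁻-inverseʳ `τ₂ (i , j) = cong (i ,_) (up-down j)
  ⟦⟧ₚ⁻-inverseʳ `id p = refl
  ⟦⟧ₚ⁻-inverseʳ (e ∘ₑ f) p = trans (cong ⟦ e ⟧ₚ⁻ (⟦⟧ₚ⁻-inverseʳ f (⟦ e ⟧ₚ p))) (⟦⟧ₚ⁻-inverseʳ e p)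
  ⟦⟧ₚ⁻-inverseʳ (e ⁻¹ₑ) p = ⟦⟧ₚ⁻-inverseˡ e p
  ⟦⟧ₚ⁻-inverseˡ `r (i , j) = cong (_, j) (rev-involutive i)
  ⟦⟧ₚ⁻-inverseˡ `s (i , j) = cong (i ,_) (rev-involutive j)
  ⟦⟧ₚ⁻-inverseˡ `τ₁ (i , j) = cong (_, j) (down-up i)
  ⟦⟧ₚ⁻-inverseˡ `τ₂ (i , j) = cong (i ,_) (down-up j)
  ⟦⟧ₚ⁻-inverseˡ `id p = refl
  ⟦⟧ₚ⁻-inverseˡ (e ∘ₑ f) p = trans (cong ⟦ f ⟧ₚ (⟦⟧ₚ⁻-inverseˡ e (⟦ f ⟧ₚ⁻ p))) (⟦⟧ₚ⁻-inverseˡ f p)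
  ⟦⟧ₚ⁻-inverseˡ (e ⁻¹ₑ) p = ⟦⟧ₚ⁻-inverseʳ e p

  private
    bijective : ∀ {f g : Fin n → Fin n} → (∀ u → f (g u) ≡ u) → (∀ u → g (f u) ≡ u) → Bijective _≡_ _≡_ f
    bijective {f} fg gf = inverseᵇ⇒bijective (strictlyInverseˡ⇒inverseˡ f fg , strictlyInverseʳ⇒inverseʳ f gf)

    _⨾_ : ∀ {f g : Fin n → Fin n} → Bijective _≡_ _≡_ f → Bijective _≡_ _≡_ g → Bijective _≡_ _≡_ (g ∘ f)
    _⨾_ = Compose.bijective _≡_ _≡_ _≡_

    rev-bijective down-bijective up-bijective : Bijective _≡_ _≡_ _
    rev-bijective = bijective {rev n} rev-involutive rev-involutive
    down-bijective = bijective {down} down-up up-down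
    up-bijective = bijective {up} up-down down-up

  ⟦⟧-Latin : ∀ e {A} → IsLatin n A → IsLatin n (⟦_⟧ n e A)
  ⟦⟧⁻-Latin : ∀ e {A} → IsLatin n A → IsLatin n (⟦_⟧⁻ n e A)
  ⟦⟧-Latin `r (rows , cols) = (λ i → rev-bijective ⨾ cols i) , (λ j → rows (rev n j))
  ⟦⟧-Latin `s (rows , cols) = (λ i → rev-bijective ⨾ rows i) , (λ j → cols (rev n j))
  ⟦⟧-Latin `τ₁ (rows , cols) = (λ i → rows (down i)) , (λ j → down-bijective ⨾ cols j)
  ⟦⟧-Latin `τ₂ (rows , cols) = (λ i → down-bijective ⨾ rows i) , (λ j → cols (down j))
  ⟦⟧-Latin `id L = L
  ⟦⟧-Latin (e ∘ₑ f) L = ⟦⟧-Latin e (⟦⟧-Latin f L)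
  ⟦⟧-Latin (e ⁻¹ₑ) L = ⟦⟧⁻-Latin e L
  ⟦⟧⁻-Latin `r (rows , cols) = (λ i → cols (rev n i)) , (λ j → rev-bijective ⨾ rows j)
  ⟦⟧⁻-Latin `s (rows , cols) = (λ i → rev-bijective ⨾ rows i) , (λ j → cols (rev n j))
  ⟦⟧⁻-Latin `τ₁ (rows , cols) = (λ i → rows (up i)) , (λ j → up-bijective ⨾ cols j)
  ⟦⟧⁻-Latin `τ₂ (rows , cols) = (λ i → up-bijective ⨾ rows i) , (λ j → cols (up j))
  ⟦⟧⁻-Latin `id L = L
  ⟦⟧⁻-Latin (e ∘ₑ f) L = ⟦⟧⁻-Latin f (⟦⟧⁻-Latin e L)
  ⟦⟧⁻-Latin (e ⁻¹ₑ) L = ⟦⟧-Latin e L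

  RespectsBlocks : Arr n → (Pt n → Pt n) → Set
  RespectsBlocks I f = ∀ p q → at I p ≡ at I q → at I (f p) ≡ at I (f q)

  ⟦⟧-orthogonal : ∀ e {S I} → Orthogonal n S I → RespectsBlocks I ⟦ e ⟧ₚ → Orthogonal n (⟦_⟧ n e S) I
  ⟦⟧-orthogonal e {S} {I} orth respects i j k l ij≢kl eq =
    orth _ _ _ _ (ij≢kl ∘ ⟦⟧ₚ-injective)
      (cong₂ _,_ (trans (sym (⟦⟧-at e S i j)) (trans (cong proj₁ eq) (⟦⟧-at e S k l)))
                 (respects (i , j) (k , l) (cong proj₂ eq)))
    where
    ⟦⟧ₚ-injective : ⟦ e ⟧ₚ (i , j) ≡ ⟦ e ⟧ₚ (k , l) → (i , j) ≡ (k , l)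
    ⟦⟧ₚ-injective eq′ = trans (sym (⟦⟧ₚ⁻-inverseʳ e (i , j))) (trans (cong ⟦ e ⟧ₚ⁻ eq′) (⟦⟧ₚ⁻-inverseʳ e (k , l)))

  PreservesBlocks : Arr n → Expr → Set
  PreservesBlocks I g = RespectsBlocks I ⟦ g ⟧ₚ × RespectsBlocks I ⟦ g ⟧ₚ⁻

  InGroup-preserves-blocks : ∀ {gs I} → (∀ {g} → g ∈ gs → PreservesBlocks I g) →
                             ∀ {g} → InGroup gs g → PreservesBlocks I g
  InGroup-preserves-blocks gens (gen g∈gs) = gens g∈gs
  InGroup-preserves-blocks gens unit = (λ _ _ eq → eq) , (λ _ _ eq → eq)
  InGroup-preserves-blocks gens (comp g h) with InGroup-preserves-blocks gens g | InGroup-preserves-blocks gens h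
  ... | g⁺ , g⁻ | h⁺ , h⁻ = (λ p q eq → h⁺ _ _ (g⁺ p q eq)) , (λ p q eq → g⁻ _ _ (h⁻ p q eq))
  InGroup-preserves-blocks gens (inv g) with InGroup-preserves-blocks gens g
  ... | g⁺ , g⁻ = g⁻ , g⁺

  InGroup-preserves-DPSudoku : ∀ {gs I S} → (∀ {g} → g ∈ gs → PreservesBlocks I g) → IsDPSudoku n I S →
                   ∀ g → InGroup gs g → IsDPSudoku n I (⟦_⟧ n g S)
  InGroup-preserves-DPSudoku gens (latin , orth) g g∈G =
    ⟦⟧-Latin g latin , ⟦⟧-orthogonal g orth (proj₁ (InGroup-preserves-blocks gens g∈G))

pos-2m+1 : ∀ m → + (2 ℕ.* m ℕ.+ 1) ≡ + 2 * + m + + 1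
pos-2m+1 m = trans (ℤP.pos-+ (2 ℕ.* m) 1) (cong (_+ + 1) (ℤP.pos-* 2 m))

∣i±j∣≤⇒∣i∣+∣j∣≤ : ∀ i j {s} → ∣ i + j ∣ ≤ s → ∣ i - j ∣ ≤ s → ∣ i ∣ ℕ.+ ∣ j ∣ ≤ s
∣i±j∣≤⇒∣i∣+∣j∣≤ (+ m)    (+ k)    i+j≤ _   = i+j≤
∣i±j∣≤⇒∣i∣+∣j∣≤ (+ m)    -[1+ k ] _   i-j≤ = i-j≤
∣i±j∣≤⇒∣i∣+∣j∣≤ -[1+ m ] (+ k) {s} _   i-j≤ =
  subst (_≤ s) (trans (ℤP.∣i-j∣≡∣j-i∣ -[1+ m ] (+ k)) (ℕP.+-comm k (suc m))) i-j≤
∣i±j∣≤⇒∣i∣+∣j∣≤ -[1+ m ] -[1+ k ] {s} i+j≤ _ = subst (_≤ s) (cong suc (sym (ℕP.+-suc m k))) i+j≤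

∣m-n∣≤n : ∀ {m n} → m ≤ n ℕ.+ n → ∣ + m - + n ∣ ≤ n
∣m-n∣≤n {m} {n} m≤2n with ℕP.≤-total m n
... | inj₁ m≤n = subst (_≤ n) (sym (trans (cong ∣_∣ (ℤP.m-n≡m⊖n m n)) (ℤP.∣⊖∣-≤ m≤n))) (ℕP.m∸n≤m n m)
... | inj₂ n≤m = subst (_≤ n) (sym (cong ∣_∣ (trans (ℤP.m-n≡m⊖n m n) (ℤP.⊖-≥ n≤m)))) (ℕP.m≤n+o⇒m∸n≤o m n m≤2n)

module Tiling (t : ℕ) where

  T : ℤ
  T = + suc t

  InA₀ : ℤ → ℤ → Set
  InA₀ i j = ∣ i ∣ ℕ.+ ∣ j ∣ ≤ t ⊎ ∣ i - + 1 ∣ ℕ.+ ∣ j ∣ ≤ t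

  private
    halve : ∀ {a b} → 2 ℕ.* a ℕ.+ 1 ≤ 2 ℕ.* b ℕ.+ 1 → a ≤ b
    halve {a} {b} h = ℕP.*-cancelˡ-≤ 2 (ℕP.+-cancelʳ-≤ 1 (2 ℕ.* a) (2 ℕ.* b) h)

    odd-right : ∀ m k → ∣ + 2 * +[1+ m ] - + 1 ∣ ℕ.+ 2 ℕ.* k ≡ 2 ℕ.* (m ℕ.+ k) ℕ.+ 1
    odd-right m k = normal-form m k
      where
      normal-form : ∀ m k → m ℕ.+ suc (m ℕ.+ 0) ℕ.+ 2 ℕ.* k ≡ 2 ℕ.* (m ℕ.+ k) ℕ.+ 1
      normal-form = ℕSolver.solve-∀

    odd-left : ∀ m k → ∣ + 2 * -[1+ m ] - + 1 ∣ ℕ.+ 2 ℕ.* k ≡ 2 ℕ.* (suc m ℕ.+ k) ℕ.+ 1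
    odd-left m k = normal-form m k
      where
      normal-form : ∀ m k → suc (suc (m ℕ.+ suc (m ℕ.+ 0) ℕ.+ 0)) ℕ.+ 2 ℕ.* k ≡ 2 ℕ.* (suc m ℕ.+ k) ℕ.+ 1
      normal-form = ℕSolver.solve-∀

  -- A₀ is the Lee ball of radius t + ½ around (½ , 0).
  InA₀-centred : ∀ i j → ∣ + 2 * i - + 1 ∣ ℕ.+ 2 ℕ.* ∣ j ∣ ≤ 2 ℕ.* t ℕ.+ 1 → InA₀ i j
  InA₀-centred +0       j h = inj₁ (halve (subst (_≤ 2 ℕ.* t ℕ.+ 1) (ℕP.+-comm 1 (2 ℕ.* ∣ j ∣)) h))
  InA₀-centred +[1+ m ] j h = inj₂ (halve (subst (_≤ 2 ℕ.* t ℕ.+ 1) (odd-right m ∣ j ∣) h))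
  InA₀-centred -[1+ m ] j h = inj₁ (halve (subst (_≤ 2 ℕ.* t ℕ.+ 1) (odd-left m ∣ j ∣) h))

  centred-residue : ∀ w → Σ[ q ∈ ℤ ] ∣ + 2 * (w - q * (+ 2 * T)) - + 1 ∣ ≤ 2 ℕ.* t ℕ.+ 1
  centred-residue w = q , subst (_≤ 2 ℕ.* t ℕ.+ 1) (cong ∣_∣ (sym shape)) (∣m-n∣≤n 2r≤)
    where
    d : ℕ
    d = 2 ℕ.* suc t
    r : ℕ
    r = (w + + t) %ℕ d
    q : ℤ
    q = (w + + t) /ℕ d
    2r≤ : 2 ℕ.* r ≤ (2 ℕ.* t ℕ.+ 1) ℕ.+ (2 ℕ.* t ℕ.+ 1)
    2r≤ = subst (2 ℕ.* r ≤_) (cong ((2 ℕ.* t ℕ.+ 1) ℕ.+_) (ℕP.+-identityʳ _))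
            (ℕP.*-monoʳ-≤ 2 (ℕ.s≤s⁻¹ (subst (suc r ≤_) (d≡ t) (n%ℕd<d (w + + t) d))))
      where
      d≡ : ∀ t → 2 ℕ.* suc t ≡ suc (2 ℕ.* t ℕ.+ 1)
      d≡ = ℕSolver.solve-∀
    shape : + 2 * (w - q * (+ 2 * T)) - + 1 ≡ + (2 ℕ.* r) - + (2 ℕ.* t ℕ.+ 1)
    shape = begin
      + 2 * (w - q * D) - + 1
        ≡⟨ regroup w (+ t) q D ⟩
      + 2 * ((w + + t) - q * D) - (+ 2 * + t + + 1)
        ≡⟨ cong (λ z → + 2 * (z - q * D) - (+ 2 * + t + + 1)) (a≡a%ℕn+[a/ℕn]*n (w + + t) d) ⟩
      + 2 * ((+ r + q * D) - q * D) - (+ 2 * + t + + 1)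
        ≡⟨ cancel (+ r) q D (+ t) ⟩
      + 2 * + r - (+ 2 * + t + + 1)
        ≡⟨ cong₂ _-_ (ℤP.pos-* 2 r) (pos-2m+1 t) ⟨
      + (2 ℕ.* r) - + (2 ℕ.* t ℕ.+ 1) ∎
      where
      open ≡-Reasoning
      D = + 2 * T
      regroup : ∀ w t q D → + 2 * (w - q * D) - + 1 ≡ + 2 * ((w + t) - q * D) - (+ 2 * t + + 1)
      regroup = solve-∀
      cancel : ∀ r q D t → + 2 * ((r + q * D) - q * D) - (+ 2 * t + + 1) ≡ + 2 * r - (+ 2 * t + + 1)
      cancel = solve-∀

  -- In the rotated coordinates (i + j , i - j) these corners form 2T ℤ² sheared by γ and A₀ is the
  -- box [-t , t + 1]², so each rotated coordinate is reduced separately by centred-residue.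
  tiling : ∀ γ p₁ p₂ → Σ[ a ∈ ℤ ] Σ[ m ∈ ℤ ] InA₀ (p₁ - (T * a + γ * a + T * m)) (p₂ - (T * a - γ * a - T * m))
  tiling γ p₁ p₂ =
    a , m , InA₀-centred i j (subst (_≤ 2 ℕ.* t ℕ.+ 1) (cong (∣ + 2 * i - + 1 ∣ ℕ.+_) (ℤP.abs-* (+ 2) j)) bound)
    where
    a m i j : ℤ
    a = proj₁ (centred-residue (p₁ + p₂))
    m = proj₁ (centred-residue (p₁ - p₂ - + 2 * γ * a))
    i = p₁ - (T * a + γ * a + T * m)
    j = p₂ - (T * a - γ * a - T * m)
    sum : ∀ p₁ p₂ a m γ T → + 2 * (p₁ + p₂ - a * (+ 2 * T)) - + 1
          ≡ (+ 2 * (p₁ - (T * a + γ * a + T * m)) - + 1) + + 2 * (p₂ - (T * a - γ * a - T * m))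
    sum = solve-∀
    difference : ∀ p₁ p₂ a m γ T → + 2 * (p₁ - p₂ - + 2 * γ * a - m * (+ 2 * T)) - + 1
          ≡ (+ 2 * (p₁ - (T * a + γ * a + T * m)) - + 1) - + 2 * (p₂ - (T * a - γ * a - T * m))
    difference = solve-∀
    bound : ∣ + 2 * i - + 1 ∣ ℕ.+ ∣ + 2 * j ∣ ≤ 2 ℕ.* t ℕ.+ 1
    bound = ∣i±j∣≤⇒∣i∣+∣j∣≤ (+ 2 * i - + 1) (+ 2 * j)
      (subst (λ z → ∣ z ∣ ≤ 2 ℕ.* t ℕ.+ 1) (sum p₁ p₂ a m γ T)
        (proj₂ (centred-residue (p₁ + p₂))))
      (subst (λ z → ∣ z ∣ ≤ 2 ℕ.* t ℕ.+ 1) (difference p₁ p₂ a m γ T)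
        (proj₂ (centred-residue (p₁ - p₂ - + 2 * γ * a))))

module _ (n : ℕ) {{_ : NonZero n}} (t : ℕ) where
  open ZMod n
  open Tiling t

  Tiles : Code n → Set
  Tiles C = ∀ p₁ p₂ → Σ[ U₁ ∈ ℤ ] Σ[ U₂ ∈ ℤ ] C (P U₁ U₂) × InA₀ (p₁ - U₁) (p₂ - U₂)

  corners-tile : ∀ γ {C} → (∀ a m → C (P (T * a + γ * a + T * m) (T * a - γ * a - T * m))) → Tiles C
  corners-tile γ corners p₁ p₂ =
    T * a + γ * a + T * m , T * a - γ * a - T * m , corners a m , proj₂ (proj₂ (tiling γ p₁ p₂))
    where
    a m : ℤ
    a = proj₁ (tiling γ p₁ p₂)
    m = proj₁ (proj₂ (tiling γ p₁ p₂))

module Anticodes (n : ℕ) {{_ : NonZero n}} (C : Code n) where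
  open ZMod n
  open Arrays n

  e₁ : Pt n
  e₁ = pt n 1 0

  CoreImage : (Pt n → Pt n) → Pt n → Set
  CoreImage f c = Σ[ c′ ∈ Pt n ] C c′ ×
    ((f c ≡ c′ × f (_⊕_ n c e₁) ≡ _⊕_ n c′ e₁) ⊎ (f c ≡ _⊕_ n c′ e₁ × f (_⊕_ n c e₁) ≡ c′))

  MapsCores : (Pt n → Pt n) → Set
  MapsCores f = ∀ c → C c → CoreImage f c

  module _ (t : ℕ) where

    MapsAnticodes : (Pt n → Pt n) → Set
    MapsAnticodes f = ∀ c → C c → Σ[ c′ ∈ Pt n ] C c′ × (∀ p → Anticode n t c p → Anticode n t c′ (f p))

    private
      moved : ∀ {f} → Isometry f → ∀ {p q q′} → f q ≡ q′ → dL n p q ≤ t → dL n (f p) q′ ≤ t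
      moved iso {p} {q} refl d≤t = subst (_≤ t) (sym (iso p q)) d≤t

    isometry-maps-anticodes : ∀ {f} → Isometry f → MapsCores f → MapsAnticodes f
    isometry-maps-anticodes {f} iso cores c c∈C with cores c c∈C
    ... | c′ , c′∈C , inj₁ (fc , fc₁) = c′ , c′∈C , λ where
          p (inj₁ d≤t) → inj₁ (moved {f} iso fc d≤t)
          p (inj₂ d≤t) → inj₂ (moved {f} iso fc₁ d≤t)
    ... | c′ , c′∈C , inj₂ (fc , fc₁) = c′ , c′∈C , λ where
          p (inj₁ d≤t) → inj₂ (moved {f} iso fc d≤t)
          p (inj₂ d≤t) → inj₁ (moved {f} iso fc₁ d≤t)

    Covers : Set
    Covers = ∀ p → Σ[ c ∈ Pt n ] C c × Anticode n t c p

    module Palette {e : Fin n → Pt n} (enum : Enumerates n e C) {I : Arr n} (palette : IsPaletteGrid n t e I) where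

      palette-constant : ∀ {c p q} → C c → Anticode n t c p → Anticode n t c q → at I p ≡ at I q
      palette-constant c∈C p∈A q∈A with proj₂ (proj₂ enum) _ c∈C
      ... | k , refl = trans (palette k _ p∈A) (sym (palette k _ q∈A))

      same-anticode : Covers → ∀ {p q} → at I p ≡ at I q →
                      Σ[ c ∈ Pt n ] C c × Anticode n t c p × Anticode n t c q
      same-anticode covers {p} {q} Ip≡Iq with covers p | covers q
      ... | c , c∈C , p∈A | d , d∈C , q∈A with proj₂ (proj₂ enum) c c∈C | proj₂ (proj₂ enum) d d∈C
      ... | i , refl | j , refl with trans (sym (palette i p p∈A)) (trans Ip≡Iq (palette j q q∈A))
      ... | refl = e i , c∈C , p∈A , q∈A

      respects-blocks : Covers → ∀ {f} → MapsAnticodes f → RespectsBlocks I f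
      respects-blocks covers maps p q Ip≡Iq with same-anticode covers Ip≡Iq
      ... | c , c∈C , p∈A , q∈A with maps c c∈C
      ... | c′ , c′∈C , image = palette-constant c′∈C (image p p∈A) (image q q∈A)

module Translates (n : ℕ) {{_ : NonZero n}} (C₀ : Code n) (lin : IsLinear n C₀) (x : Pt n) where
  open ZMod n
  open IsLinear lin
  open Anticodes n (Translate n x C₀)

  X₁ X₂ : ℤ
  X₁ = ι (proj₁ x)
  X₂ = ι (proj₂ x)

  negation-closed : ∀ u v → C₀ (P u v) → C₀ (P (- u) (- v))
  negation-closed u v uv∈C₀ =
    subst C₀ (trans (⊙-P (- + 1) u v) (cong₂ P (ℤP.-1*i≡-i u) (ℤP.-1*i≡-i v))) (closed-· ⟪ - + 1 ⟫ (P u v) uv∈C₀)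

  private
    x⊕P : ∀ u v → _⊕_ n x (P u v) ≡ P (X₁ + u) (X₂ + v)
    x⊕P u v = trans (cong (λ y → _⊕_ n y (P u v)) (sym (P-ι x))) (⊕-P X₁ X₂ u v)

    x⊕P⊕e₁ : ∀ u v → _⊕_ n (_⊕_ n x (P u v)) e₁ ≡ P (X₁ + u + + 1) (X₂ + v)
    x⊕P⊕e₁ u v = trans (cong (λ y → _⊕_ n y e₁) (x⊕P u v))
                       (trans (⊕-P (X₁ + u) (X₂ + v) (+ 1) (+ 0)) (cong (P (X₁ + u + + 1)) (ℤP.+-identityʳ (X₂ + v))))

    via-P : ∀ {p q a b a′ b′} → p ≡ P a b → q ≡ P a′ b′ → a ≡ a′ → b ≡ b′ → p ≡ q
    via-P p≡ q≡ refl refl = trans p≡ (sym q≡)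

    in-translate : ∀ {u v} → C₀ (P u v) → Translate n x C₀ (_⊕_ n x (P u v))
    in-translate uv∈C₀ = _ , uv∈C₀ , refl

    maps-cores-P : ∀ {f} → (∀ u v → C₀ (P u v) → CoreImage f (_⊕_ n x (P u v))) → MapsCores f
    maps-cores-P {f} image _ (c₀ , c₀∈C₀ , refl) =
      subst (λ c₀ → CoreImage f (_⊕_ n x c₀)) (P-ι c₀)
        (image (ι (proj₁ c₀)) (ι (proj₂ c₀)) (subst C₀ (sym (P-ι c₀)) c₀∈C₀))

    mirror : ∀ X v → - (X + v) + + 2 * X ≡ X + - v
    mirror = solve-∀

    at-core : ∀ {s₁ s₂ A B f} → Affine s₁ s₂ A B f → ∀ u v →
              f (_⊕_ n x (P u v)) ≡ P (signed s₁ (X₁ + u) + A) (signed s₂ (X₂ + v) + B)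
    at-core {f = f} aff u v = trans (cong f (x⊕P u v)) (at-P aff (X₁ + u) (X₂ + v))

    at-core₁ : ∀ {s₁ s₂ A B f} → Affine s₁ s₂ A B f → ∀ u v →
               f (_⊕_ n (_⊕_ n x (P u v)) e₁) ≡ P (signed s₁ (X₁ + u + + 1) + A) (signed s₂ (X₂ + v) + B)
    at-core₁ {f = f} aff u v = trans (cong f (x⊕P⊕e₁ u v)) (at-P aff (X₁ + u + + 1) (X₂ + v))

  translation-maps-cores : ∀ {A B f} → Affine Sign.+ Sign.+ A B f → C₀ (P A B) → MapsCores f
  translation-maps-cores {A} {B} aff AB∈C₀ = maps-cores-P λ u v uv∈C₀ →
    _ , in-translate {u + A} {v + B} (subst C₀ (⊕-P u v A B) (closed-+ (P u v) (P A B) uv∈C₀ AB∈C₀)) ,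
    inj₁ ( via-P (at-core aff u v) (x⊕P (u + A) (v + B)) (ℤP.+-assoc X₁ u A) (ℤP.+-assoc X₂ v B)
         , via-P (at-core₁ aff u v) (x⊕P⊕e₁ (u + A) (v + B)) (shift X₁ u A) (ℤP.+-assoc X₂ v B))
    where
    shift : ∀ X u A → X + u + + 1 + A ≡ X + (u + A) + + 1
    shift = solve-∀

  -- (a , b) ↦ (2 X₁ + 1 - a , 2 X₂ - b) is the half-turn about the centre x + (½ , 0) of the core of x.
  half-turn-maps-cores : ∀ {f} → Affine Sign.- Sign.- (+ 2 * X₁ + + 1) (+ 2 * X₂) f → MapsCores f
  half-turn-maps-cores aff = maps-cores-P λ u v uv∈C₀ →
    _ , in-translate { - u} { - v} (negation-closed u v uv∈C₀) ,
    inj₂ ( via-P (at-core aff u v) (x⊕P⊕e₁ (- u) (- v)) (flip X₁ u) (mirror X₂ v)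
         , via-P (at-core₁ aff u v) (x⊕P (- u) (- v)) (flip₁ X₁ u) (mirror X₂ v))
    where
    flip : ∀ X u → - (X + u) + (+ 2 * X + + 1) ≡ X + - u + + 1
    flip = solve-∀
    flip₁ : ∀ X u → - (X + u + + 1) + (+ 2 * X + + 1) ≡ X + - u
    flip₁ = solve-∀

  column-reflection-maps-cores : ∀ {f} → Affine Sign.+ Sign.- (+ 0) (+ 2 * X₂) f →
                                (∀ u v → C₀ (P u v) → C₀ (P u (- v))) → MapsCores f
  column-reflection-maps-cores aff column-closed = maps-cores-P λ u v uv∈C₀ →
    _ , in-translate {u} { - v} (column-closed u v uv∈C₀) ,
    inj₁ ( via-P (at-core aff u v) (x⊕P u (- v)) (ℤP.+-identityʳ (X₁ + u)) (mirror X₂ v)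
         , via-P (at-core₁ aff u v) (x⊕P⊕e₁ u (- v)) (ℤP.+-identityʳ (X₁ + u + + 1)) (mirror X₂ v))

  covers-from-tiling : ∀ t → Tiles n t C₀ → Covers t
  covers-from-tiling t tiles p with tiles (ι (proj₁ p) - X₁) (ι (proj₂ p) - X₂)
  ... | U₁ , U₂ , U∈C₀ , inA₀ = c , in-translate {U₁} {U₂} U∈C₀ , anticode inA₀
    where
    c : Pt n
    c = _⊕_ n x (P U₁ U₂)
    a b : ℤ
    a = ι (proj₁ p)
    b = ι (proj₂ p)
    regroup : ∀ a X U → a - (X + U) ≡ a - X - U
    regroup = solve-∀
    regroup₁ : ∀ a X U → a - (X + U + + 1) ≡ a - X - U - + 1
    regroup₁ = solve-∀
    anticode : Tiling.InA₀ t (a - X₁ - U₁) (b - X₂ - U₂) → Anticode n t c p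
    anticode (inj₁ near) = inj₁ (ℕP.≤-trans
      (subst (dL n p c ≤_) (cong₂ (λ i j → ∣ i ∣ ℕ.+ ∣ j ∣) (regroup a X₁ U₁) (regroup b X₂ U₂))
        (dL-≤ a b (X₁ + U₁) (X₂ + U₂) (sym (P-ι p)) (x⊕P U₁ U₂))) near)
    anticode (inj₂ near) = inj₂ (ℕP.≤-trans
      (subst (dL n p (_⊕_ n c e₁) ≤_) (cong₂ (λ i j → ∣ i ∣ ℕ.+ ∣ j ∣) (regroup₁ a X₁ U₁) (regroup b X₂ U₂))
        (dL-≤ a b (X₁ + U₁ + + 1) (X₂ + U₂) (sym (P-ι p)) (x⊕P⊕e₁ U₁ U₂))) near)

module Generators (n : ℕ) {{_ : NonZero n}} where
  open ZMod n
  open Arrays n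

  private
    sub-sub : ∀ a k → a - + 1 - k ≡ a - (+ 1 + k)
    sub-sub = solve-∀

    pos-2m+2 : ∀ m → + (2 ℕ.* m ℕ.+ 2) ≡ + 2 * + m + + 2
    pos-2m+2 m = trans (ℤP.pos-+ (2 ℕ.* m) 2) (cong (_+ + 2) (ℤP.pos-* 2 m))

  τ₁^-P : ∀ k a b → ⟦ `τ₁ ^ₑ k ⟧ₚ (P a b) ≡ P (a - + k) b
  τ₁^-P zero    a b = cong (λ a → P a b) (sym (ℤP.+-identityʳ a))
  τ₁^-P (suc k) a b = begin
    ⟦ `τ₁ ^ₑ k ⟧ₚ (down ⟪ a ⟫ , ⟪ b ⟫)   ≡⟨ cong (λ i → ⟦ `τ₁ ^ₑ k ⟧ₚ (i , ⟪ b ⟫)) (-ₙ-⟪⟫ a (+ 1)) ⟩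
    ⟦ `τ₁ ^ₑ k ⟧ₚ (P (a - + 1) b)       ≡⟨ τ₁^-P k (a - + 1) b ⟩
    P (a - + 1 - + k) b                 ≡⟨ cong (λ a → P a b) (sub-sub a (+ k)) ⟩
    P (a - + suc k) b                   ∎
    where open ≡-Reasoning

  τ₂^-P : ∀ k a b → ⟦ `τ₂ ^ₑ k ⟧ₚ (P a b) ≡ P a (b - + k)
  τ₂^-P zero    a b = cong (P a) (sym (ℤP.+-identityʳ b))
  τ₂^-P (suc k) a b = begin
    ⟦ `τ₂ ^ₑ k ⟧ₚ (⟪ a ⟫ , down ⟪ b ⟫)   ≡⟨ cong (λ j → ⟦ `τ₂ ^ₑ k ⟧ₚ (⟪ a ⟫ , j)) (-ₙ-⟪⟫ b (+ 1)) ⟩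
    ⟦ `τ₂ ^ₑ k ⟧ₚ (P a (b - + 1))       ≡⟨ τ₂^-P k a (b - + 1) ⟩
    P a (b - + 1 - + k)                 ≡⟨ cong (P a) (sub-sub b (+ k)) ⟩
    P a (b - + suc k)                   ∎
    where open ≡-Reasoning

  shift-affine : ∀ k l → Affine Sign.+ Sign.+ (- + k) (- + l) ⟦ (`τ₁ ^ₑ k) ∘ₑ (`τ₂ ^ₑ l) ⟧ₚ
  shift-affine k l = affine λ a b → trans (cong ⟦ `τ₂ ^ₑ l ⟧ₚ (τ₁^-P k a b)) (τ₂^-P l (a - + k) b)

  column-shift-affine : ∀ l → Affine Sign.+ Sign.+ (+ 0) (- + l) ⟦ `τ₂ ^ₑ l ⟧ₚ
  column-shift-affine l = affine λ a b → trans (τ₂^-P l a b) (cong (λ a → P a (b - + l)) (sym (ℤP.+-identityʳ a)))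

  column-reflection-affine : ∀ m → Affine Sign.+ Sign.- (+ 0) (+ 2 * + m) ⟦ (`τ₂ ^ₑ (2 ℕ.* m ℕ.+ 1)) ∘ₑ `s ⟧ₚ
  column-reflection-affine m = affine λ a b → begin
    ⟦ `s ⟧ₚ (⟦ `τ₂ ^ₑ (2 ℕ.* m ℕ.+ 1) ⟧ₚ (P a b))
      ≡⟨ cong ⟦ `s ⟧ₚ (τ₂^-P (2 ℕ.* m ℕ.+ 1) a b) ⟩
    ⟪ a ⟫ , rev n ⟪ b - + (2 ℕ.* m ℕ.+ 1) ⟫
      ≡⟨ cong (⟪ a ⟫ ,_) (rev-⟪⟫ (b - + (2 ℕ.* m ℕ.+ 1))) ⟩
    P a (- + 1 - (b - + (2 ℕ.* m ℕ.+ 1)))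
      ≡⟨ cong₂ P (sym (ℤP.+-identityʳ a)) (trans (cong (λ k → - + 1 - (b - k)) (pos-2m+1 m)) (mirror b (+ m))) ⟩
    P (a + + 0) (- b + + 2 * + m)
      ∎
    where
    open ≡-Reasoning
    mirror : ∀ b m → - + 1 - (b - (+ 2 * m + + 1)) ≡ - b + + 2 * m
    mirror = solve-∀

  half-turn-affine : ∀ m₁ m₂ → Affine Sign.- Sign.- (+ 2 * + m₁ + + 1) (+ 2 * + m₂)
                       ⟦ (`τ₁ ^ₑ (2 ℕ.* m₁ ℕ.+ 2)) ∘ₑ ((`τ₂ ^ₑ (2 ℕ.* m₂ ℕ.+ 1)) ∘ₑ (`r ^ₑ 2)) ⟧ₚ
  half-turn-affine m₁ m₂ = affine λ a b → begin
    ⟦ `r ^ₑ 2 ⟧ₚ (⟦ `τ₂ ^ₑ k₂ ⟧ₚ (⟦ `τ₁ ^ₑ k₁ ⟧ₚ (P a b)))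
      ≡⟨ cong (⟦ `r ^ₑ 2 ⟧ₚ ∘ ⟦ `τ₂ ^ₑ k₂ ⟧ₚ) (τ₁^-P k₁ a b) ⟩
    ⟦ `r ^ₑ 2 ⟧ₚ (⟦ `τ₂ ^ₑ k₂ ⟧ₚ (P (a - + k₁) b))
      ≡⟨ cong ⟦ `r ^ₑ 2 ⟧ₚ (τ₂^-P k₂ (a - + k₁) b) ⟩
    rev n ⟪ a - + k₁ ⟫ , rev n ⟪ b - + k₂ ⟫
      ≡⟨ cong₂ _,_ (rev-⟪⟫ (a - + k₁)) (rev-⟪⟫ (b - + k₂)) ⟩
    P (- + 1 - (a - + k₁)) (- + 1 - (b - + k₂))
      ≡⟨ cong₂ P (trans (cong (λ k → - + 1 - (a - k)) (pos-2m+2 m₁)) (turn₁ a (+ m₁)))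
                 (trans (cong (λ k → - + 1 - (b - k)) (pos-2m+1 m₂)) (turn₂ b (+ m₂))) ⟩
    P (- a + (+ 2 * + m₁ + + 1)) (- b + + 2 * + m₂)
      ∎
    where
    open ≡-Reasoning
    k₁ k₂ : ℕ
    k₁ = 2 ℕ.* m₁ ℕ.+ 2
    k₂ = 2 ℕ.* m₂ ℕ.+ 1
    turn₁ : ∀ a m → - + 1 - (a - (+ 2 * m + + 2)) ≡ - a + (+ 2 * m + + 1)
    turn₁ = solve-∀
    turn₂ : ∀ b m → - + 1 - (b - (+ 2 * m + + 1)) ≡ - b + + 2 * m
    turn₂ = solve-∀

module Preservation (n : ℕ) {{_ : NonZero n}} (t : ℕ) (C₀ : Code n) (lin : IsLinear n C₀) (x : Pt n)
  {e : Fin n → Pt n} (enum : Enumerates n e (Translate n x C₀))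
  {I : Arr n} (palette : IsPaletteGrid n t e I)
  (covers : Anticodes.Covers n (Translate n x C₀) t) where
  open ZMod n
  open Arrays n
  open Anticodes n (Translate n x C₀)
  open Translates n C₀ lin x
  open Palette t enum palette

  private
    respects : ∀ {s₁ s₂ A B f} → Affine s₁ s₂ A B f → MapsCores f → RespectsBlocks I f
    respects aff cores = respects-blocks covers (isometry-maps-anticodes t (affine-isometry aff) cores)

    inverse : ∀ {s₁ s₂ A B} g → Affine s₁ s₂ A B ⟦ g ⟧ₚ →
              Affine s₁ s₂ (inverse-offset s₁ A) (inverse-offset s₂ B) ⟦ g ⟧ₚ⁻
    inverse g = affine-inverse (⟦⟧ₚ⁻-inverseʳ g)

  translation-preserves : ∀ {A B} g → Affine Sign.+ Sign.+ A B ⟦ g ⟧ₚ → C₀ (P A B) → PreservesBlocks I g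
  translation-preserves {A} {B} g aff AB∈C₀ =
    respects aff (translation-maps-cores aff AB∈C₀) ,
    respects (inverse g aff) (translation-maps-cores (inverse g aff) (negation-closed A B AB∈C₀))

  half-turn-preserves : ∀ g → Affine Sign.- Sign.- (+ 2 * X₁ + + 1) (+ 2 * X₂) ⟦ g ⟧ₚ → PreservesBlocks I g
  half-turn-preserves g aff =
    respects aff (half-turn-maps-cores aff) , respects (inverse g aff) (half-turn-maps-cores (inverse g aff))

  column-reflection-preserves : ∀ g → Affine Sign.+ Sign.- (+ 0) (+ 2 * X₂) ⟦ g ⟧ₚ →
                                (∀ u v → C₀ (P u v) → C₀ (P u (- v))) → PreservesBlocks I g
  column-reflection-preserves g aff closed =
    respects aff (column-reflection-maps-cores aff closed) ,
    respects (inverse g aff) (column-reflection-maps-cores (inverse g aff) closed)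

module Lattices (t : ℕ) where
  open ZMod (N t)
  open Tiling t using (T)

  private
    D E : ℤ
    D = + 2 * T
    E = + 2 * + t + + 1

    C′-combination : ∀ K M →
      _⊕_ (N t) (_⊙_ (N t) ⟪ K ⟫ (pt (N t) (suc t) (suc t)))
                (_⊕_ (N t) (_⊙_ (N t) ⟪ M ⟫ (pt (N t) 0 (2 ℕ.* suc t))) (0ₚ (N t)))
      ≡ P (K * T) (K * T + M * D)
    C′-combination K M = begin
      _⊕_ (N t) (_⊙_ (N t) ⟪ K ⟫ (P T T)) (_⊕_ (N t) (_⊙_ (N t) ⟪ M ⟫ (P (+ 0) D)) (P (+ 0) (+ 0)))
        ≡⟨ cong (_⊕_ (N t) (_⊙_ (N t) ⟪ K ⟫ (P T T))) (⊙⊕-P M (+ 0) D (+ 0) (+ 0)) ⟩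
      _⊕_ (N t) (_⊙_ (N t) ⟪ K ⟫ (P T T)) (P (M * + 0 + + 0) (M * D + + 0))
        ≡⟨ ⊙⊕-P K T T (M * + 0 + + 0) (M * D + + 0) ⟩
      P (K * T + (M * + 0 + + 0)) (K * T + (M * D + + 0))
        ≡⟨ cong₂ P (simplify₁ K M T) (simplify₂ K M T D) ⟩
      P (K * T) (K * T + M * D) ∎
      where
      open ≡-Reasoning
      simplify₁ : ∀ K M T → K * T + (M * + 0 + + 0) ≡ K * T
      simplify₁ = solve-∀
      simplify₂ : ∀ K M T D → K * T + (M * D + + 0) ≡ K * T + M * D
      simplify₂ = solve-∀

  C′-intro : ∀ K M → C′ (N t) t (P (K * T) (K * T + M * D))
  C′-intro K M = ⟪ K ⟫ , _ , (⟪ M ⟫ , 0ₚ (N t) , refl , refl) , sym (C′-combination K M)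

  C′-elim : ∀ {p} → C′ (N t) t p → Σ[ K ∈ ℤ ] Σ[ M ∈ ℤ ] p ≡ P (K * T) (K * T + M * D)
  C′-elim (k , _ , (l , _ , refl , refl) , refl) =
    ι k , ι l , trans (cong₂ (λ k l → _⊕_ (N t) (_⊙_ (N t) k (pt (N t) (suc t) (suc t)))
                                           (_⊕_ (N t) (_⊙_ (N t) l (pt (N t) 0 (2 ℕ.* suc t))) (0ₚ (N t))))
                             (sym (⟪ι⟫ k)) (sym (⟪ι⟫ l)))
                      (C′-combination (ι k) (ι l))

  C′-swap : ∀ p → C′ (N t) t p → C′ (N t) t (swapₚ (N t) p)
  C′-swap p p∈C′ with C′-elim p∈C′
  ... | K , M , refl = subst (C′ (N t) t) (cong₂ P (swap₁ K M T) (swap₂ K M T)) (C′-intro (K + + 2 * M) (- M))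
    where
    swap₁ : ∀ K M T → (K + + 2 * M) * T ≡ K * T + M * (+ 2 * T)
    swap₁ = solve-∀
    swap₂ : ∀ K M T → (K + + 2 * M) * T + - M * (+ 2 * T) ≡ K * T
    swap₂ = solve-∀

  C′-column-closed : ∀ u v → C′ (N t) t (P u v) → C′ (N t) t (P u (- v))
  C′-column-closed u v uv∈C′ with C′-elim uv∈C′
  ... | K , M , eq = subst (C′ (N t) t) (sym (P-cong u≈ (≈-trans (neg-cong v≈) (≡⇒≈ (negate K M T)))))
                       (C′-intro K (- (K + M)))
    where
    u≈ : u ≈ K * T
    u≈ = proj₁ (P-≈ {u} {K * T} {v} {K * T + M * D} eq)
    v≈ : v ≈ K * T + M * D
    v≈ = proj₂ (P-≈ {u} {K * T} {v} {K * T + M * D} eq)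
    negate : ∀ K M T → - (K * T + M * (+ 2 * T)) ≡ K * T + - (K + M) * (+ 2 * T)
    negate = solve-∀

  C″-intro : ∀ u v → v ≈ u * E → C″ (N t) t (P u v)
  C″-intro u v v≈uE = ⟪ u ⟫ , 0ₚ (N t) , refl ,
    trans (P-cong (≡⇒≈ (sym (trans (ℤP.+-identityʳ _) (ℤP.*-identityʳ u))))
                  (≈-trans v≈uE (≡⇒≈ (sym (trans (ℤP.+-identityʳ _) (cong (u *_) (pos-2m+1 t)))))))
          (sym (⊙⊕-P u (+ 1) (+ (2 ℕ.* t ℕ.+ 1)) (+ 0) (+ 0)))

  C′-diagonal : C′ (N t) t (P T T)
  C′-diagonal = subst (C′ (N t) t) (cong₂ P (ℤP.*-identityˡ T) (trans (ℤP.+-identityʳ _) (ℤP.*-identityˡ T)))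
                  (C′-intro (+ 1) (+ 0))

  C′-column : C′ (N t) t (P (+ 0) (+ (2 ℕ.* suc t)))
  C′-column = subst (C′ (N t) t) (cong (P (+ 0)) (trans (ℤP.+-identityˡ _) (ℤP.*-identityˡ D))) (C′-intro (+ 0) (+ 1))

  C′-corner : ∀ a m → C′ (N t) t (P (T * a + + 0 * a + T * m) (T * a - + 0 * a - T * m))
  C′-corner a m = subst (C′ (N t) t) (cong₂ P (corner₁ a m T) (corner₂ a m T)) (C′-intro (a + m) (- m))
    where
    corner₁ : ∀ a m T → (a + m) * T ≡ T * a + + 0 * a + T * m
    corner₁ = solve-∀
    corner₂ : ∀ a m T → (a + m) * T + - m * (+ 2 * T) ≡ T * a - + 0 * a - T * m
    corner₂ = solve-∀

  -- τ stands for + t, so that 1 + τ, 2τ + 1 and 2(1 + τ)² are T, E and n up to conversion.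
  C″-corner : ∀ a m → C″ (N t) t (P (T * a + - + t * a + T * m) (T * a - - + t * a - T * m))
  C″-corner a m = C″-intro (T * a + - + t * a + T * m) (T * a - - + t * a - T * m) (- m , corner (+ t) a m)
    where
    corner : ∀ τ a m → (+ 1 + τ) * a - - τ * a - (+ 1 + τ) * m
           ≡ ((+ 1 + τ) * a + - τ * a + (+ 1 + τ) * m) * (+ 2 * τ + + 1) + - m * (+ 2 * ((+ 1 + τ) * (+ 1 + τ)))
    corner = solve-∀

  C″-corner-swapped : ∀ a m → C″ (N t) t (P (T * a - + t * a - T * m) (T * a + + t * a + T * m))
  C″-corner-swapped a m = C″-intro (T * a - + t * a - T * m) (T * a + + t * a + T * m) (m , corner (+ t) a m)
    where
    corner : ∀ τ a m → (+ 1 + τ) * a + τ * a + (+ 1 + τ) * m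
           ≡ ((+ 1 + τ) * a - τ * a - (+ 1 + τ) * m) * (+ 2 * τ + + 1) + m * (+ 2 * ((+ 1 + τ) * (+ 1 + τ)))
    corner = solve-∀

module _ (t : ℕ) (C₀ : Code (N t)) (lin : IsLinear (N t) C₀) (x : Pt (N t)) where
  open ZMod (N t)
  open Arrays (N t)
  open Tiling t using (T)
  open Lattices t
  open Generators (N t)
  open Translates (N t) C₀ lin x using (negation-closed; covers-from-tiling)

  CaseI⇒C′ : CaseI (N t) t C₀ → SameCode (N t) C₀ (C′ (N t) t)
  CaseI⇒C′ (inj₁ C₀≡C′) = C₀≡C′
  CaseI⇒C′ (inj₂ swapped) p =
    (λ p∈C₀ → C′-swap (swapₚ (N t) p) (proj₁ (swapped (swapₚ (N t) p)) p∈C₀)) ,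
    (λ p∈C′ → proj₂ (swapped (swapₚ (N t) p)) (C′-swap p p∈C′))

  caseI-preserves : CaseI (N t) t C₀ → PreservesSudoku t (Translate (N t) x C₀) (gensI t x)
  caseI-preserves case _ enum I palette _ sudoku = InGroup-preserves-DPSudoku generators sudoku
    where
    from-C′ : ∀ {p} → C′ (N t) t p → C₀ p
    from-C′ {p} = proj₂ (CaseI⇒C′ case p)

    open Preservation (N t) t C₀ lin x enum palette
                      (covers-from-tiling t (corners-tile (N t) t (+ 0) {C₀} λ a m → from-C′ (C′-corner a m)))

    generators : ∀ {g} → g ∈ gensI t x → PreservesBlocks I g
    generators {g} (here refl) =
      translation-preserves g (shift-affine (suc t) (suc t)) (negation-closed T T (from-C′ C′-diagonal))
    generators {g} (there (here refl)) =
      translation-preserves g (column-shift-affine (2 ℕ.* suc t))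
        (negation-closed (+ 0) (+ (2 ℕ.* suc t)) (from-C′ C′-column))
    generators {g} (there (there (here refl))) =
      column-reflection-preserves g (column-reflection-affine (toℕ (proj₂ x)))
        (λ u v uv∈C₀ → from-C′ (C′-column-closed u v (proj₁ (CaseI⇒C′ case (P u v)) uv∈C₀)))
    generators {g} (there (there (there (here refl)))) =
      half-turn-preserves g (half-turn-affine (toℕ (proj₁ x)) (toℕ (proj₂ x)))

  caseII-preserves : ∀ a b → SameCode (N t) C₀ (Span (N t) ((a , b) ∷ [])) →
                     CaseII (N t) t C₀ → PreservesSudoku t (Translate (N t) x C₀) (gensII t x a b)
  caseII-preserves a b C₀≡span case _ enum I palette _ sudoku = InGroup-preserves-DPSudoku generators sudoku
    where
    tiles : CaseII (N t) t C₀ → Tiles (N t) t C₀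
    tiles (inj₁ C₀≡C″) = corners-tile (N t) t (- + t) {C₀} λ a m →
      proj₂ (C₀≡C″ (P (T * a + - + t * a + T * m) (T * a - - + t * a - T * m))) (C″-corner a m)
    tiles (inj₂ swapped) = corners-tile (N t) t (+ t) {C₀} λ a m →
      proj₂ (swapped (P (T * a - + t * a - T * m) (T * a + + t * a + T * m))) (C″-corner-swapped a m)

    open Preservation (N t) t C₀ lin x enum palette (covers-from-tiling t (tiles case))

    ab∈C₀ : C₀ (P (ι a) (ι b))
    ab∈C₀ = subst C₀ (sym (P-ι (a , b))) (proj₂ (C₀≡span (a , b)) (generator∈Span (a , b)))

    generators : ∀ {g} → g ∈ gensII t x a b → PreservesBlocks I g
    generators {g} (here refl) =
      translation-preserves g (shift-affine (toℕ a) (toℕ b)) (negation-closed (ι a) (ι b) ab∈C₀)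
    generators {g} (there (here refl)) =
      half-turn-preserves g (half-turn-affine (toℕ (proj₁ x)) (toℕ (proj₂ x)))

theorem9 : (t : ℕ) → 1 ≤ t →
    (C₀ : Code (N t)) → IsLinear (N t) C₀ → IsDiamPerfect (N t) t C₀ →
    (x : Pt (N t)) →
    (CaseI (N t) t C₀ → PreservesSudoku t (Translate (N t) x C₀) (gensI t x))
    × ((a b : Fin (N t)) → SameCode (N t) C₀ (Span (N t) ((a , b) ∷ [])) →
       CaseII (N t) t C₀ → PreservesSudoku t (Translate (N t) x C₀) (gensII t x a b))
theorem9 t _ C₀ lin _ x = caseI-preserves t C₀ lin x , caseII-preserves t C₀ lin x
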